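{- Let $L$ be a complete lattice and let $S$ be a subsemiring of $\mathrm{FinAdd}_L$ (i.e. $\bot,\mathrm{id}\in S$ and $S$ is closed under $\vee$ and composition) closed under $f\mapsto f^*$. Then $S$ is a $^*$-continuous Kleene algebra if and only if for all $g,h\in S$, $g^*h=\bigvee_{n\ge0}g^nh$.
   Context: Functions are written on the right and composed left to right: $xf$ is $f$ applied to $x$, $fg$ means "first $f$, then $g$". For a complete lattice $L$, $f:L\to L$ is finitely additive if $\bot f=\bot$ and $(x\vee y)f=xf\vee yf$; $\mathrm{FinAdd}_L$ is the set of such maps, ordered pointwise with pointwise suprema; $\bot$ also denotes the constant $\bot$ map and $\mathrm{id}$ the identity. For $f\in\mathrm{FinAdd}_L$: $f^0=\mathrm{id}$, $f^{n+1}=f^nf$, $f^*=\bigvee_{n\ge0}f^n$ (pointwise). All suprema are pointwise. $S$ is a $^*$-continuous Kleene algebra if it is a Kleene algebra (for all $x,y\in S$, $yx^*$ is the least $z\in S$ with $z=zx\vee y$ and $x^*y$ the least $z\in S$ with $z=xz\vee y$), $x^*=\bigvee_nx^n$, and $y(\bigvee_nx^n)=\bigvee_nyx^n$ and $(\bigvee_nx^n)y=\bigvee_nx^ny$ for all $x,y\in S$. -}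

module Defs where

open import Level using (Level; _⊔_; Lift) renaming (suc to lsuc)
open import Data.Nat using (ℕ; zero; suc)
open import Data.Empty using () renaming (⊥ to Empty)
open import Data.Sum using (_⊎_)
open import Data.Product using (_×_; ∃)
open import Relation.Unary using (Pred)
open import Relation.Binary.PropositionalEquality using (_≡_)
open import Relation.Binary.Structures using (IsPartialOrder)

record CompleteLattice (c ℓ : Level) : Set (lsuc (c ⊔ ℓ)) where
  field
    Carrier        : Set c
    _≤_            : Carrier → Carrier → Set ℓ
    isPartialOrder : IsPartialOrder _≡_ _≤_
    ⋁              : Pred Carrier c → Carrier
    ⋁-upper        : ∀ (P : Pred Carrier c) x → P x → x ≤ ⋁ P
    ⋁-least        : ∀ (P : Pred Carrier c) u → (∀ x → P x → x ≤ u) → ⋁ P ≤ u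

module _ {c ℓ : Level} (L : CompleteLattice c ℓ) where
  open CompleteLattice L

  ⊥L : Carrier
  ⊥L = ⋁ (λ _ → Lift c Empty)

  _∨L_ : Carrier → Carrier → Carrier
  x ∨L y = ⋁ (λ b → (b ≡ x) ⊎ (b ≡ y))

  ⋁ℕ : (ℕ → Carrier) → Carrier
  ⋁ℕ x = ⋁ (λ b → ∃ λ n → b ≡ x n)

  -- maps L → L; "x f" in the paper is "f x" here
  Map : Set c
  Map = Carrier → Carrier

  -- diagrammatic composition: f ⨾ g = "first f, then g" (the paper's fg)
  _⨾_ : Map → Map → Map
  (f ⨾ g) a = g (f a)

  FinAdd : Map → Set c
  FinAdd f = (f ⊥L ≡ ⊥L) × (∀ x y → f (x ∨L y) ≡ (f x ∨L f y))

  _≐_ : Map → Map → Set c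
  f ≐ g = ∀ a → f a ≡ g a

  ⊥M : Map
  ⊥M _ = ⊥L

  idM : Map
  idM a = a

  _∨M_ : Map → Map → Map
  (f ∨M g) a = f a ∨L g a

  ⋁M : (ℕ → Map) → Map
  ⋁M F a = ⋁ℕ (λ n → F n a)

  pow : Map → ℕ → Map
  pow f zero    = idM
  pow f (suc n) = pow f n ⨾ f

  star : Map → Map
  star f = ⋁M (pow f)

  record IsStarSubsemiring {s : Level} (S : Pred Map s) : Set (c ⊔ s) where
    field
      ⊆FinAdd : ∀ f → S f → FinAdd f
      ⊥∈      : S ⊥M
      id∈     : S idM
      ∨-closed : ∀ f g → S f → S g → S (f ∨M g)
      ⨾-closed : ∀ f g → S f → S g → S (f ⨾ g)
      *-closed : ∀ f → S f → S (star f)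

  _≤M_ : Map → Map → Set c
  f ≤M g = (f ∨M g) ≐ g

  record IsKleeneAlgebra {s : Level} (S : Pred Map s) : Set (c ⊔ s) where
    field
      ∨-assoc  : ∀ x y z → S x → S y → S z → ((x ∨M y) ∨M z) ≐ (x ∨M (y ∨M z))
      ∨-comm   : ∀ x y → S x → S y → (x ∨M y) ≐ (y ∨M x)
      ∨-idem   : ∀ x → S x → (x ∨M x) ≐ x
      ∨-identity : ∀ x → S x → (⊥M ∨M x) ≐ x
      ⨾-assoc  : ∀ x y z → S x → S y → S z → ((x ⨾ y) ⨾ z) ≐ (x ⨾ (y ⨾ z))
      ⨾-identityˡ : ∀ x → S x → (idM ⨾ x) ≐ x
      ⨾-identityʳ : ∀ x → S x → (x ⨾ idM) ≐ x
      distribˡ : ∀ x y z → S x → S y → S z → (x ⨾ (y ∨M z)) ≐ ((x ⨾ y) ∨M (x ⨾ z))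
      distribʳ : ∀ x y z → S x → S y → S z → ((y ∨M z) ⨾ x) ≐ ((y ⨾ x) ∨M (z ⨾ x))
      zeroˡ    : ∀ x → S x → (⊥M ⨾ x) ≐ ⊥M
      zeroʳ    : ∀ x → S x → (x ⨾ ⊥M) ≐ ⊥M
      *-fixʳ   : ∀ x y → S x → S y → (y ⨾ star x) ≐ (((y ⨾ star x) ⨾ x) ∨M y)
      *-leastʳ : ∀ x y z → S x → S y → S z → z ≐ ((z ⨾ x) ∨M y) → (y ⨾ star x) ≤M z
      *-fixˡ   : ∀ x y → S x → S y → (star x ⨾ y) ≐ ((x ⨾ (star x ⨾ y)) ∨M y)
      *-leastˡ : ∀ x y z → S x → S y → S z → z ≐ ((x ⨾ z) ∨M y) → (star x ⨾ y) ≤M z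

  record IsStarContinuousKA {s : Level} (S : Pred Map s) : Set (c ⊔ s) where
    field
      isKleeneAlgebra : IsKleeneAlgebra S
      star-sup   : ∀ x → S x → star x ≐ ⋁M (pow x)
      contˡ      : ∀ x y → S x → S y → (y ⨾ ⋁M (pow x)) ≐ ⋁M (λ n → y ⨾ pow x n)
      contʳ      : ∀ x y → S x → S y → (⋁M (pow x) ⨾ y) ≐ ⋁M (λ n → pow x n ⨾ y)

module Submission where

-- With pointwise operations most of the structure is definitional: the
-- supremum law f* = ⋁ₙ fⁿ and left continuity y(⋁ₙ xⁿ) = ⋁ₙ y xⁿ hold by
-- refl, and right continuity is literally the hypothesis.  So "⇒" projects
-- right continuity, and the content of "⇐" is the Kleene algebra axioms.

open import Defs
open import Level using (Level; _⊔_)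
open import Relation.Unary using (Pred)
open import Function.Bundles using (_⇔_; mk⇔)
open import Data.Nat using (ℕ; zero; suc)
open import Data.Sum using (inj₁; inj₂)
open import Data.Product using (_,_; proj₁; proj₂)
open import Relation.Binary.PropositionalEquality
  using (_≡_; refl; sym; trans; cong; subst; module ≡-Reasoning)
open import Relation.Binary.Structures using (IsPartialOrder)

module _ {c ℓ : Level} (L : CompleteLattice c ℓ) where
  open CompleteLattice L
  open IsPartialOrder isPartialOrder using (antisym)
    renaming (refl to ≤-refl; trans to ≤-trans)

  private
    _∨_ : Carrier → Carrier → Carrier
    _∨_ = _∨L_ L
    infixr 30 _∨_

  ≤-respʳ : ∀ {a b b′} → b′ ≡ b → a ≤ b → a ≤ b′
  ≤-respʳ {a} e = subst (a ≤_) (sym e)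

  ≤-respˡ : ∀ {a a′ b} → a′ ≡ a → a ≤ b → a′ ≤ b
  ≤-respˡ {b = b} e = subst (_≤ b) (sym e)

  ∨-upperˡ : ∀ x y → x ≤ x ∨ y
  ∨-upperˡ x y = ⋁-upper _ x (inj₁ refl)

  ∨-upperʳ : ∀ x y → y ≤ x ∨ y
  ∨-upperʳ x y = ⋁-upper _ y (inj₂ refl)

  ∨-least : ∀ {x y u} → x ≤ u → y ≤ u → x ∨ y ≤ u
  ∨-least {x} {y} {u} p q = ⋁-least _ u λ { _ (inj₁ refl) → p ; _ (inj₂ refl) → q }

  ⊥-least : ∀ x → ⊥L L ≤ x
  ⊥-least x = ⋁-least _ x λ { _ () }

  ≤⇒∨≡ : ∀ {a b} → a ≤ b → a ∨ b ≡ b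
  ≤⇒∨≡ {a} {b} p = antisym (∨-least p ≤-refl) (∨-upperʳ a b)

  ∨-assoc : ∀ x y z → (x ∨ y) ∨ z ≡ x ∨ (y ∨ z)
  ∨-assoc x y z = antisym
    (∨-least (∨-least (∨-upperˡ _ _) (≤-trans (∨-upperˡ y z) (∨-upperʳ _ _)))
             (≤-trans (∨-upperʳ y z) (∨-upperʳ _ _)))
    (∨-least (≤-trans (∨-upperˡ x y) (∨-upperˡ _ _))
             (∨-least (≤-trans (∨-upperʳ x y) (∨-upperˡ _ _)) (∨-upperʳ _ _)))

  ∨-comm : ∀ x y → x ∨ y ≡ y ∨ x
  ∨-comm x y = antisym (∨-least (∨-upperʳ _ _) (∨-upperˡ _ _))
                       (∨-least (∨-upperʳ _ _) (∨-upperˡ _ _))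

  ∨-idem : ∀ x → x ∨ x ≡ x
  ∨-idem x = ≤⇒∨≡ ≤-refl

  ∨-identityˡ : ∀ x → ⊥L L ∨ x ≡ x
  ∨-identityˡ x = ≤⇒∨≡ (⊥-least x)

  ⋁ℕ-upper : ∀ (f : ℕ → Carrier) n → f n ≤ ⋁ℕ L f
  ⋁ℕ-upper f n = ⋁-upper _ (f n) (n , refl)

  ⋁ℕ-least : ∀ (f : ℕ → Carrier) {u} → (∀ n → f n ≤ u) → ⋁ℕ L f ≤ u
  ⋁ℕ-least f {u} p = ⋁-least _ u λ { _ (n , refl) → p n }

  ⋁ℕ-cong : ∀ {f g : ℕ → Carrier} → (∀ n → f n ≡ g n) → ⋁ℕ L f ≡ ⋁ℕ L g
  ⋁ℕ-cong {f} {g} e = antisym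
    (⋁ℕ-least f λ n → ≤-respˡ (e n) (⋁ℕ-upper g n))
    (⋁ℕ-least g λ n → ≤-respˡ (sym (e n)) (⋁ℕ-upper f n))

  ⋁ℕ-unfold : ∀ (f : ℕ → Carrier) → ⋁ℕ L f ≡ ⋁ℕ L (λ n → f (suc n)) ∨ f 0
  ⋁ℕ-unfold f = antisym
    (⋁ℕ-least f λ { zero    → ∨-upperʳ _ _
                  ; (suc n) → ≤-trans (⋁ℕ-upper (λ n → f (suc n)) n) (∨-upperˡ _ _) })
    (∨-least (⋁ℕ-least _ λ n → ⋁ℕ-upper f (suc n)) (⋁ℕ-upper f 0))

  Monotone : Map L → Set (c ⊔ ℓ)
  Monotone f = ∀ {a b} → a ≤ b → f a ≤ f b

  -- Finitely additive maps preserve ≤, since a ≤ b means a ∨ b = b.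
  finAdd-monotone : ∀ f → FinAdd L f → Monotone f
  finAdd-monotone f (_ , f-∨) {a} {b} a≤b =
    ≤-respʳ (trans (cong f (sym (≤⇒∨≡ a≤b))) (f-∨ a b)) (∨-upperˡ (f a) (f b))

  -- xⁿ x = x xⁿ, in the diagrammatic order: xⁿ applied after x.
  pow-comm : ∀ (x : Map L) n a → pow L x n (x a) ≡ x (pow L x n a)
  pow-comm x zero    a = refl
  pow-comm x (suc n) a = cong x (pow-comm x n a)

  -- y is continuous along the powers of x:  y (⋁ₙ xⁿ a) = ⋁ₙ y (xⁿ a).
  -- This is the condition  x* y = ⋁ₙ xⁿ y  of the theorem, read pointwise.
  ContinuousAlong : Map L → Map L → Set c
  ContinuousAlong x y = ∀ a → y (star L x a) ≡ ⋁ℕ L (λ n → y (pow L x n a))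

  -- x* = x* x ∨ id (the law y x* = (y x*) x ∨ y at the point y a),
  -- provided x is continuous along its own powers.
  star-unfoldʳ : ∀ (x : Map L) → ContinuousAlong x x → ∀ b → star L x b ≡ x (star L x b) ∨ b
  star-unfoldʳ x x-cont b = begin
    star L x b                        ≡⟨ ⋁ℕ-unfold (λ n → pow L x n b) ⟩
    ⋁ℕ L (λ n → x (pow L x n b)) ∨ b  ≡⟨ cong (_∨ b) (sym (x-cont b)) ⟩
    x (star L x b) ∨ b                ∎
    where open ≡-Reasoning

  star-unfoldˡ : ∀ (x y : Map L) → ContinuousAlong x y →
                 ∀ a → y (star L x a) ≡ y (star L x (x a)) ∨ y a
  star-unfoldˡ x y y-cont a = begin
    y (star L x a)                               ≡⟨ y-cont a ⟩
    ⋁ℕ L (λ n → y (pow L x n a))                 ≡⟨ ⋁ℕ-unfold (λ n → y (pow L x n a)) ⟩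
    ⋁ℕ L (λ n → y (x (pow L x n a))) ∨ y a
      ≡⟨ cong (_∨ y a) (⋁ℕ-cong λ n → cong y (sym (pow-comm x n a))) ⟩
    ⋁ℕ L (λ n → y (pow L x n (x a))) ∨ y a       ≡⟨ cong (_∨ y a) (sym (y-cont (x a))) ⟩
    y (star L x (x a)) ∨ y a                     ∎
    where open ≡-Reasoning

  star-leastʳ : ∀ (x y z : Map L) → Monotone x → (∀ a → z a ≡ x (z a) ∨ y a) →
                ∀ a → star L x (y a) ≤ z a
  star-leastʳ x y z x-mono z-sol a = ⋁ℕ-least _ below
    where
    below : ∀ n → pow L x n (y a) ≤ z a
    below zero    = ≤-respʳ (z-sol a) (∨-upperʳ _ _)
    below (suc n) = ≤-respʳ (z-sol a) (≤-trans (x-mono (below n)) (∨-upperˡ _ _))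

  -- Every solution z of z = x z ∨ y lies above x* y: by induction on n
  -- (generalising the point) each xⁿ y lies below z; continuity of y along
  -- the powers of x then bounds the supremum.
  star-leastˡ : ∀ (x y z : Map L) → ContinuousAlong x y → (∀ a → z a ≡ z (x a) ∨ y a) →
                ∀ a → y (star L x a) ≤ z a
  star-leastˡ x y z y-cont z-sol a =
    ≤-respˡ (y-cont a) (⋁ℕ-least _ λ n → below n a)
    where
    below : ∀ n a → y (pow L x n a) ≤ z a
    below zero    a = ≤-respʳ (z-sol a) (∨-upperʳ _ _)
    below (suc n) a = ≤-respˡ (cong y (sym (pow-comm x n a)))
      (≤-respʳ (z-sol a) (≤-trans (below n (x a)) (∨-upperˡ _ _)))

  -- The semiring laws need only that the
  -- operations are pointwise, plus finite additivity for ⊥ x = ⊥ and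
  -- (y ∨ z) x = y x ∨ z x.
  kleeneAlgebra : ∀ {s} (S : Pred (Map L) s) → IsStarSubsemiring L S →
                  (∀ g h → S g → S h → ContinuousAlong g h) → IsKleeneAlgebra L S
  kleeneAlgebra S S-semiring cont = record
    { ∨-assoc     = λ x y z _ _ _ a → ∨-assoc (x a) (y a) (z a)
    ; ∨-comm      = λ x y _ _ a → ∨-comm (x a) (y a)
    ; ∨-idem      = λ x _ a → ∨-idem (x a)
    ; ∨-identity  = λ x _ a → ∨-identityˡ (x a)
    ; ⨾-assoc     = λ _ _ _ _ _ _ _ → refl
    ; ⨾-identityˡ = λ _ _ _ → refl
    ; ⨾-identityʳ = λ _ _ _ → refl
    ; distribˡ    = λ _ _ _ _ _ _ _ → refl
    ; distribʳ    = λ x y z Sx _ _ a → proj₂ (⊆FinAdd x Sx) (y a) (z a)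
    ; zeroˡ       = λ x Sx _ → proj₁ (⊆FinAdd x Sx)
    ; zeroʳ       = λ _ _ _ → refl
    ; *-fixʳ      = λ x y Sx _ a → star-unfoldʳ x (cont x x Sx Sx) (y a)
    ; *-leastʳ    = λ x y z Sx _ _ z-sol a →
        ≤⇒∨≡ (star-leastʳ x y z (finAdd-monotone x (⊆FinAdd x Sx)) z-sol a)
    ; *-fixˡ      = λ x y Sx Sy → star-unfoldˡ x y (cont x y Sx Sy)
    ; *-leastˡ    = λ x y z Sx Sy _ z-sol a →
        ≤⇒∨≡ (star-leastˡ x y z (cont x y Sx Sy) z-sol a)
    }
    where open IsStarSubsemiring S-semiring using (⊆FinAdd)

mainTheorem9 : ∀ {c ℓ s : Level} (L : CompleteLattice c ℓ) (S : Pred (Map L) s) →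
    IsStarSubsemiring L S →
    (IsStarContinuousKA L S ⇔
      (∀ g h → S g → S h → _≐_ L (_⨾_ L (star L g) h) (⋁M L (λ n → _⨾_ L (pow L g n) h))))
mainTheorem9 L S S-semiring = mk⇔
  IsStarContinuousKA.contʳ
  (λ cont → record
    { isKleeneAlgebra = kleeneAlgebra L S S-semiring cont
    ; star-sup        = λ _ _ _ → refl
    ; contˡ           = λ _ _ _ _ _ → refl
    ; contʳ           = cont
    })
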